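{- Let $n,R$ be positive integers, $\mathcal{U}=(u_{klr}),\mathcal{V}=(v_{klr}),\mathcal{W}=(w_{ijr})\in\mathbb{R}^{n\times n\times R}$, and for $\mathbf{A},\mathbf{B}\in\mathbb{R}^{n\times n}$ let $f(\mathbf{A},\mathbf{B})\in\mathbb{R}^{n\times n}$ be given by $f(\mathbf{A},\mathbf{B})_{ij}=\sum_{r=1}^R w_{ijr}\big(\sum_{k,l=1}^n u_{klr}a_{kl}\big)\big(\sum_{k',l'=1}^n v_{k'l'r}b_{k'l'}\big)$. Suppose $(4n+R-1)\varepsilon_{\mathrm{machine}}\le 0.01$ and that the entries of $\mathbf{A},\mathbf{B},\mathcal{U},\mathcal{V},\mathcal{W}$ are floating point numbers. Then, with $\mathrm{fl}(f(\mathbf{A},\mathbf{B}))$ the result of evaluating this formula in floating point arithmetic as described in the context, $$\|\mathrm{fl}(f(\mathbf{A},\mathbf{B}))-f(\mathbf{A},\mathbf{B})\|\le 1.01(4n+R-1)\sqrt{R}\,\varepsilon_{\mathrm{machine}}\|\mathbf{A}\|\|\mathbf{B}\|\sqrt{\sum_{r=1}^R\|\mathbf{U}_{::r}\|^2\|\mathbf{V}_{::r}\|^2\|\mathbf{W}_{::r}\|^2}.$$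
   Context: $\|\cdot\|$ is the Frobenius norm; $\mathbf{U}_{::r}\in\mathbb{R}^{n\times n}$ is the $r$-th frontal slice of $\mathcal{U}$ (entries $u_{klr}$), similarly for $\mathbf{V}_{::r},\mathbf{W}_{::r}$. Floating point model: for floating point numbers $x,y$ and $\mathrm{op}\in\{+,-,\times\}$, $\mathrm{fl}(x\,\mathrm{op}\,y)=(x\,\mathrm{op}\,y)(1+\Delta)$ with $|\Delta|\le\varepsilon_{\mathrm{machine}}$ (unit roundoff). Sums are evaluated sequentially, e.g. $\mathrm{fl}(\sum_{n=1}^3x_n)=\mathrm{fl}(\mathrm{fl}(\mathrm{fl}(x_1)+\mathrm{fl}(x_2))+\mathrm{fl}(x_3))$. In evaluating $f$: each $\sum_{k,l}u_{klr}a_{kl}$ is computed by forming the products $u_{klr}a_{kl}$, summing sequentially over $l$ for each $k$, then summing these partial sums sequentially over $k$ (similarly for the $\mathbf{B}$ factor); then $w_{ijr}$ times the two factors is computed with two floating point multiplications, and the resulting $R$ terms are summed sequentially over $r$. -}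

module Defs where

open import Data.Nat as ℕ using (ℕ)
open import Data.Integer using (+_)
open import Data.Fin using (Fin)
open import Data.List using (List; []; _∷_; foldl; map; allFin)
open import Data.Product using (∃-syntax; _×_)
open import Relation.Binary.PropositionalEquality using (_≡_)
open import Data.Rational using (ℚ; _+_; _-_; _*_; _/_; _≤_; ∣_∣; 0ℚ; 1ℚ)

-- All data (floating point numbers, unit roundoff) are rationals.
Mat : ℕ → Set
Mat n = Fin n → Fin n → ℚ

Tensor : ℕ → ℕ → Set
Tensor n R = Fin n → Fin n → Fin R → ℚ

ℕ→ℚ : ℕ → ℚ
ℕ→ℚ m = + m / 1

seqSum : (ℚ → ℚ → ℚ) → List ℚ → ℚ
seqSum add []       = 0ℚ
seqSum add (x ∷ xs) = foldl add x xs

ΣF : (ℚ → ℚ → ℚ) → (m : ℕ) → (Fin m → ℚ) → ℚ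
ΣF add m x = seqSum add (map x (allFin m))

Σ[_]_ : (m : ℕ) → (Fin m → ℚ) → ℚ
Σ[ m ] x = ΣF _+_ m x

FlModel : ℚ → (ℚ → ℚ → ℚ) → (ℚ → ℚ → ℚ) → Set
FlModel ε op flop = ∀ x y → ∃[ Δ ] (∣ Δ ∣ ≤ ε × flop x y ≡ op x y * (1ℚ + Δ))

normSq : (n : ℕ) → Mat n → ℚ
normSq n M = Σ[ n ] (λ i → Σ[ n ] (λ j → M i j * M i j))

slice : ∀ {n R} → Tensor n R → Fin R → Mat n
slice T r k l = T k l r

fExact : (n R : ℕ) → Tensor n R → Tensor n R → Tensor n R → Mat n → Mat n → Mat n
fExact n R U V W A B i j =
  Σ[ R ] (λ r → W i j r
                * (Σ[ n ] (λ k → Σ[ n ] (λ l → U k l r * A k l)))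
                * (Σ[ n ] (λ k → Σ[ n ] (λ l → V k l r * B k l))))

fFl : (flAdd flMul : ℚ → ℚ → ℚ) →
      (n R : ℕ) → Tensor n R → Tensor n R → Tensor n R → Mat n → Mat n → Mat n
fFl flAdd flMul n R U V W A B i j =
  ΣF flAdd R (λ r →
    flMul (flMul (W i j r)
                 (ΣF flAdd n (λ k → ΣF flAdd n (λ l → flMul (U k l r) (A k l)))))
          (ΣF flAdd n (λ k → ΣF flAdd n (λ l → flMul (V k l r) (B k l)))))

_-ₘ_ : ∀ {n} → Mat n → Mat n → Mat n
(M -ₘ N) i j = M i j - N i j

-- Each computed value x̂ is tracked together with its exact counterpart x and a magnitude
-- m ≥ ∣x∣ (the same computation carried out on absolute values): after k nested roundings,
-- each of which multiplies by some 1 + δ with ∣δ∣ ≤ ε, one has ∣x̂ − x∣ ≤ ((1 + ε)^k − 1) m.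
-- Entry (i, j) of f(A, B) passes through at most K = 4n + R − 1 roundings and has magnitude
-- Σ_r ∣w_ijr∣ ⟨∣U_r∣, ∣A∣⟩ ⟨∣V_r∣, ∣B∣⟩. Cauchy–Schwarz bounds each inner product by Frobenius
-- norms and the square of the sum over r by R times the sum of squares; summing the squared
-- entry errors and exchanging the sums over (i, j) and r produces ‖W_r‖². Finally
-- (1 + ε)^K − 1 ≤ Kε (1 + Kε) ≤ 1.01 Kε.
module Submission where

open import Defs
open import Data.Nat as ℕ using (ℕ)
open import Data.Integer using (+_)
open import Data.Rational using (ℚ; _+_; _-_; _*_; _/_; _≤_)

open import Algebra.Bundles using (CommutativeRing)
open import Data.Empty using (⊥-elim)
open import Data.Fin using (Fin; zero; suc)
import Data.Integer as ℤ
open import Data.Integer.Tactic.RingSolver using () renaming (solve-∀ to ℤ-solve-∀)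
open import Data.List using (List; []; _∷_; foldl; map; tabulate; length)
open import Data.List.Properties using (length-tabulate; map-tabulate)
open import Data.Nat.Coprimality using (1-coprimeTo)
import Data.Nat.Coprimality as Coprime
import Data.Nat.Properties as ℕₚ
open import Data.Nat.Tactic.RingSolver using () renaming (solve-∀ to ℕ-solve-∀)
open import Data.Product using (_,_)
open import Data.Rational using (_<_; ∣_∣; 0ℚ; 1ℚ; -_; mkℚ; nonNegative; positive)
open import Data.Rational.Properties
open import Data.Rational.Solver using (module +-*-Solver)
import Data.Rational.Unnormalised as ℚᵘ
import Data.Rational.Unnormalised.Properties as ℚᵘₚ
open import Data.Sum using (inj₁; inj₂)
open import Data.Unit using (tt)
open import Function using (_∘_)
open import Relation.Binary.PropositionalEquality
open import Relation.Nullary using (yes; no)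
open import Relation.Nullary.Decidable using (toWitness)

open import Algebra.Properties.Semiring.Exp (CommutativeRing.semiring +-*-commutativeRing)
  using (_^_; ^-homo-*)
open import Algebra.Properties.Semiring.Sum (CommutativeRing.semiring +-*-commutativeRing)
  using (sum; sum-cong-≗; ∑-comm; *-distribˡ-sum)
open +-*-Solver using (solve; _:+_; _:-_; :-_; _:*_; _:=_; con)

*-mono-≤-nonNeg : ∀ {p q r s} → 0ℚ ≤ p → 0ℚ ≤ r → p ≤ q → r ≤ s → p * r ≤ q * s
*-mono-≤-nonNeg {q = q} {r = r} 0≤p 0≤r p≤q r≤s =
  ≤-trans (*-monoʳ-≤-nonNeg r {{nonNegative 0≤r}} p≤q)
          (*-monoˡ-≤-nonNeg q {{nonNegative (≤-trans 0≤p p≤q)}} r≤s)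

*-nonNeg : ∀ {p q} → 0ℚ ≤ p → 0ℚ ≤ q → 0ℚ ≤ p * q
*-nonNeg 0≤p 0≤q = *-mono-≤-nonNeg ≤-refl ≤-refl 0≤p 0≤q

p*p≡∣p∣*∣p∣ : ∀ p → p * p ≡ ∣ p ∣ * ∣ p ∣
p*p≡∣p∣*∣p∣ p with ∣p∣≡p∨∣p∣≡-p p
... | inj₁ ∣p∣≡p  rewrite ∣p∣≡p  = refl
... | inj₂ ∣p∣≡-p rewrite ∣p∣≡-p = solve 1 (λ p → p :* p := (:- p) :* (:- p)) refl p

0≤p*p : ∀ p → 0ℚ ≤ p * p
0≤p*p p rewrite p*p≡∣p∣*∣p∣ p = *-nonNeg (0≤∣p∣ p) (0≤∣p∣ p)

p*p≤q*q⇒p≤q : ∀ {p q} → 0ℚ ≤ q → p * p ≤ q * q → p ≤ q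
p*p≤q*q⇒p≤q {p} {q} 0≤q p*p≤q*q with p ≤? q
... | yes p≤q = p≤q
... | no  p≰q = ⊥-elim (<-irrefl refl (<-≤-trans q*q<p*p p*p≤q*q))
  where
  q<p : q < p
  q<p = ≰⇒> p≰q
  q*q<p*p : q * q < p * p
  q*q<p*p = ≤-<-trans (*-monoˡ-≤-nonNeg q {{nonNegative 0≤q}} (<⇒≤ q<p))
                      (*-monoˡ-<-pos p {{positive (≤-<-trans 0≤q q<p)}} q<p)

ℕ→ℚ≡mkℚ : ∀ m → ℕ→ℚ m ≡ mkℚ (+ m) 0 (Coprime.sym (1-coprimeTo m))
ℕ→ℚ≡mkℚ m = normalize-coprime (Coprime.sym (1-coprimeTo m))

ℕ→ℚ-suc : ∀ m → ℕ→ℚ (ℕ.suc m) ≡ 1ℚ + ℕ→ℚ m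
ℕ→ℚ-suc m rewrite ℕ→ℚ≡mkℚ m | ℕ→ℚ≡mkℚ (ℕ.suc m) =
  toℚᵘ-injective (ℚᵘₚ.≃-trans (ℚᵘ.*≡* (cross-multiplied (+ m)))
                              (ℚᵘₚ.≃-sym (toℚᵘ-homo-+ 1ℚ (mkℚ (+ m) 0 (Coprime.sym (1-coprimeTo m))))))
  where
  cross-multiplied : ∀ (x : ℤ.ℤ) → (+ 1 ℤ.+ x) ℤ.* + 1 ≡ (+ 1 ℤ.* + 1 ℤ.+ x ℤ.* + 1) ℤ.* + 1
  cross-multiplied = ℤ-solve-∀

0≤ℕ→ℚ : ∀ m → 0ℚ ≤ ℕ→ℚ m
0≤ℕ→ℚ ℕ.zero    = ≤-refl
0≤ℕ→ℚ (ℕ.suc m) rewrite ℕ→ℚ-suc m = +-mono-≤ (nonNegative⁻¹ 1ℚ) (0≤ℕ→ℚ m)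

foldl-+-tabulate : ∀ {m} a (f : Fin m → ℚ) → foldl _+_ a (tabulate f) ≡ a + sum f
foldl-+-tabulate {ℕ.zero}  a f = sym (+-identityʳ a)
foldl-+-tabulate {ℕ.suc m} a f =
  trans (foldl-+-tabulate (a + f zero) (f ∘ suc)) (+-assoc a (f zero) (sum (f ∘ suc)))

Σ≡sum : ∀ m (f : Fin m → ℚ) → Σ[ m ] f ≡ sum f
Σ≡sum ℕ.zero    f = refl
Σ≡sum (ℕ.suc m) f = trans (cong (foldl _+_ (f zero)) (map-tabulate suc f))
                          (foldl-+-tabulate (f zero) (f ∘ suc))

Σ²≡sum² : ∀ m (f : Fin m → Fin m → ℚ) →
          Σ[ m ] (λ k → Σ[ m ] (λ l → f k l)) ≡ sum (λ k → sum (λ l → f k l))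
Σ²≡sum² m f = trans (Σ≡sum m _) (sum-cong-≗ (λ k → Σ≡sum m (f k)))

sum-mono-≤ : ∀ {m} {f g : Fin m → ℚ} → (∀ i → f i ≤ g i) → sum f ≤ sum g
sum-mono-≤ {ℕ.zero}  f≤g = ≤-refl
sum-mono-≤ {ℕ.suc m} f≤g = +-mono-≤ (f≤g zero) (sum-mono-≤ (f≤g ∘ suc))

sum-nonNeg : ∀ {m} {f : Fin m → ℚ} → (∀ i → 0ℚ ≤ f i) → 0ℚ ≤ sum f
sum-nonNeg {ℕ.zero}  0≤f = ≤-refl
sum-nonNeg {ℕ.suc m} 0≤f = +-mono-≤ (0≤f zero) (sum-nonNeg (0≤f ∘ suc))

sum-ones : ∀ m → sum {m} (λ _ → 1ℚ) ≡ ℕ→ℚ m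
sum-ones ℕ.zero    = refl
sum-ones (ℕ.suc m) = trans (cong (λ s → 1ℚ + s) (sum-ones m)) (sym (ℕ→ℚ-suc m))

-- (2ax)² = 4a²x² ≤ 4pqst ≤ (pt + qs)², the last step by (pt − qs)² ≥ 0.
cross-term-≤ : ∀ {a x p q s t} → 0ℚ ≤ p → 0ℚ ≤ q → 0ℚ ≤ s → 0ℚ ≤ t →
               a * a ≤ p * q → x * x ≤ s * t → a * x + a * x ≤ p * t + q * s
cross-term-≤ {a} {x} {p} {q} {s} {t} 0≤p 0≤q 0≤s 0≤t a²≤pq x²≤st =
  p*p≤q*q⇒p≤q (+-mono-≤ (*-nonNeg 0≤p 0≤t) (*-nonNeg 0≤q 0≤s)) (begin
    (a * x + a * x) * (a * x + a * x)
      ≡⟨ solve 2 (λ a x → (a :* x :+ a :* x) :* (a :* x :+ a :* x)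
                          := con (+ 4 / 1) :* ((a :* a) :* (x :* x))) refl a x ⟩
    + 4 / 1 * ((a * a) * (x * x))
      ≤⟨ *-monoˡ-≤-nonNeg (+ 4 / 1) (*-mono-≤-nonNeg (0≤p*p a) (0≤p*p x) a²≤pq x²≤st) ⟩
    + 4 / 1 * ((p * q) * (s * t))
      ≡⟨ sym (+-identityʳ _) ⟩
    + 4 / 1 * ((p * q) * (s * t)) + 0ℚ
      ≤⟨ +-monoʳ-≤ (+ 4 / 1 * ((p * q) * (s * t))) (0≤p*p (p * t - q * s)) ⟩
    + 4 / 1 * ((p * q) * (s * t)) + (p * t - q * s) * (p * t - q * s)
      ≡⟨ solve 4 (λ p q s t → con (+ 4 / 1) :* ((p :* q) :* (s :* t)) :+ (p :* t :- q :* s) :* (p :* t :- q :* s)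
                              := (p :* t :+ q :* s) :* (p :* t :+ q :* s)) refl p q s t ⟩
    (p * t + q * s) * (p * t + q * s) ∎)
  where open ≤-Reasoning

cauchy-schwarz : ∀ {m} (x p q : Fin m → ℚ) → (∀ i → 0ℚ ≤ p i) → (∀ i → 0ℚ ≤ q i) →
                 (∀ i → x i * x i ≤ p i * q i) → sum x * sum x ≤ sum p * sum q
cauchy-schwarz {ℕ.zero}  x p q 0≤p 0≤q x²≤pq = ≤-refl
cauchy-schwarz {ℕ.suc m} x p q 0≤p 0≤q x²≤pq = begin
  (x₀ + X) * (x₀ + X)
    ≡⟨ solve 2 (λ a x → (a :+ x) :* (a :+ x) := a :* a :+ x :* x :+ (a :* x :+ a :* x)) refl x₀ X ⟩
  x₀ * x₀ + X * X + (x₀ * X + x₀ * X)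
    ≤⟨ +-mono-≤ (+-mono-≤ (x²≤pq zero) X²≤PQ)
                (cross-term-≤ {x₀} {X} (0≤p zero) (0≤q zero) 0≤P 0≤Q (x²≤pq zero) X²≤PQ) ⟩
  p₀ * q₀ + P * Q + (p₀ * Q + q₀ * P)
    ≡⟨ solve 4 (λ p q P Q → p :* q :+ P :* Q :+ (p :* Q :+ q :* P) := (p :+ P) :* (q :+ Q)) refl p₀ q₀ P Q ⟩
  (p₀ + P) * (q₀ + Q) ∎
  where
  open ≤-Reasoning
  x₀ = x zero
  p₀ = p zero
  q₀ = q zero
  X = sum (x ∘ suc)
  P = sum (p ∘ suc)
  Q = sum (q ∘ suc)
  0≤P = sum-nonNeg (0≤p ∘ suc)
  0≤Q = sum-nonNeg (0≤q ∘ suc)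
  X²≤PQ = cauchy-schwarz (x ∘ suc) (p ∘ suc) (q ∘ suc) (0≤p ∘ suc) (0≤q ∘ suc) (x²≤pq ∘ suc)

sum²≤m*sum-sq : ∀ {m} (x : Fin m → ℚ) → sum x * sum x ≤ ℕ→ℚ m * sum (λ i → x i * x i)
sum²≤m*sum-sq {m} x = subst (λ s → sum x * sum x ≤ s * sum (λ i → x i * x i)) (sum-ones m)
  (cauchy-schwarz x (λ _ → 1ℚ) (λ i → x i * x i) (λ _ → nonNegative⁻¹ 1ℚ) (λ i → 0≤p*p (x i))
                  (λ i → ≤-reflexive (sym (*-identityˡ (x i * x i)))))

⟪_,_⟫ : ∀ {n} → Mat n → Mat n → ℚ
⟪_,_⟫ {n} X Y = Σ[ n ] (λ k → Σ[ n ] (λ l → X k l * Y k l))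

∣_∣ₘ : ∀ {n} → Mat n → Mat n
∣ X ∣ₘ k l = ∣ X k l ∣

0≤normSq : ∀ {n} (X : Mat n) → 0ℚ ≤ normSq n X
0≤normSq {n} X = subst (0ℚ ≤_) (sym (Σ²≡sum² n (λ k l → X k l * X k l)))
                       (sum-nonNeg (λ k → sum-nonNeg (λ l → 0≤p*p (X k l))))

⟪⟫-cauchy-schwarz : ∀ {n} (X Y : Mat n) → ⟪ X , Y ⟫ * ⟪ X , Y ⟫ ≤ normSq n X * normSq n Y
⟪⟫-cauchy-schwarz {n} X Y = begin
  ⟪ X , Y ⟫ * ⟪ X , Y ⟫
    ≡⟨ cong (λ s → s * s) (Σ²≡sum² n (λ k l → X k l * Y k l)) ⟩
  sum (λ k → sum (λ l → X k l * Y k l)) * sum (λ k → sum (λ l → X k l * Y k l))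
    ≤⟨ cauchy-schwarz _ _ _ (λ k → sum-nonNeg (λ l → 0≤p*p (X k l))) (λ k → sum-nonNeg (λ l → 0≤p*p (Y k l)))
         (λ k → cauchy-schwarz _ _ _ (λ l → 0≤p*p (X k l)) (λ l → 0≤p*p (Y k l))
                  (λ l → ≤-reflexive (square-of-product (X k l) (Y k l)))) ⟩
  sum (λ k → sum (λ l → X k l * X k l)) * sum (λ k → sum (λ l → Y k l * Y k l))
    ≡⟨ sym (cong₂ _*_ (Σ²≡sum² n (λ k l → X k l * X k l)) (Σ²≡sum² n (λ k l → Y k l * Y k l))) ⟩
  normSq n X * normSq n Y ∎
  where
  open ≤-Reasoning
  square-of-product : ∀ x y → (x * y) * (x * y) ≡ (x * x) * (y * y)
  square-of-product = solve 2 (λ x y → (x :* y) :* (x :* y) := (x :* x) :* (y :* y)) refl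

normSq-∣∣ₘ : ∀ {n} (X : Mat n) → normSq n ∣ X ∣ₘ ≡ normSq n X
normSq-∣∣ₘ {n} X = begin
  normSq n ∣ X ∣ₘ                        ≡⟨ Σ²≡sum² n (λ k l → ∣ X k l ∣ * ∣ X k l ∣) ⟩
  sum (λ k → sum (λ l → ∣ X k l ∣ * ∣ X k l ∣)) ≡⟨ sum-cong-≗ (λ k → sum-cong-≗ (λ l → sym (p*p≡∣p∣*∣p∣ (X k l)))) ⟩
  sum (λ k → sum (λ l → X k l * X k l))  ≡⟨ sym (Σ²≡sum² n (λ k l → X k l * X k l)) ⟩
  normSq n X                             ∎
  where open ≡-Reasoning

⟪∣∣⟫-cauchy-schwarz : ∀ {n} (X Y : Mat n) →
                      ⟪ ∣ X ∣ₘ , ∣ Y ∣ₘ ⟫ * ⟪ ∣ X ∣ₘ , ∣ Y ∣ₘ ⟫ ≤ normSq n X * normSq n Y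
⟪∣∣⟫-cauchy-schwarz X Y =
  subst₂ (λ p q → ⟪ ∣ X ∣ₘ , ∣ Y ∣ₘ ⟫ * ⟪ ∣ X ∣ₘ , ∣ Y ∣ₘ ⟫ ≤ p * q) (normSq-∣∣ₘ X) (normSq-∣∣ₘ Y)
         (⟪⟫-cauchy-schwarz ∣ X ∣ₘ ∣ Y ∣ₘ)

weighted-product-sq-≤ : ∀ {w a b p q} → a * a ≤ p → b * b ≤ q →
                        (∣ w ∣ * a * b) * (∣ w ∣ * a * b) ≤ (p * q) * (w * w)
weighted-product-sq-≤ {w} {a} {b} {p} {q} a²≤p b²≤q = begin
  (∣ w ∣ * a * b) * (∣ w ∣ * a * b)
    ≡⟨ solve 3 (λ v a b → (v :* a :* b) :* (v :* a :* b) := (a :* a :* (b :* b)) :* (v :* v)) refl ∣ w ∣ a b ⟩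
  (a * a * (b * b)) * (∣ w ∣ * ∣ w ∣)
    ≡⟨ cong (λ s → (a * a * (b * b)) * s) (sym (p*p≡∣p∣*∣p∣ w)) ⟩
  (a * a * (b * b)) * (w * w)
    ≤⟨ *-monoʳ-≤-nonNeg (w * w) {{nonNegative (0≤p*p w)}} (*-mono-≤-nonNeg (0≤p*p a) (0≤p*p b) a²≤p b²≤q) ⟩
  (p * q) * (w * w) ∎
  where open ≤-Reasoning

*-distribˡ-sum² : ∀ {m} a (f : Fin m → Fin m → ℚ) →
                  a * sum (λ i → sum (λ j → f i j)) ≡ sum (λ i → sum (λ j → a * f i j))
*-distribˡ-sum² {m} a f =
  trans (*-distribˡ-sum a (λ i → sum {m} (f i))) (sum-cong-≗ (λ i → *-distribˡ-sum a (f i)))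

sum²-sum-comm : ∀ {m p} (f : Fin m → Fin m → Fin p → ℚ) →
                sum (λ i → sum (λ j → sum (λ r → f i j r))) ≡ sum (λ r → sum (λ i → sum (λ j → f i j r)))
sum²-sum-comm f = trans (sum-cong-≗ (λ i → ∑-comm (f i))) (∑-comm (λ i r → sum (λ j → f i j r)))

sq-≤-of-abs-≤-sum : ∀ {R d} c (x u : Fin R → ℚ) → ∣ d ∣ ≤ c * Σ[ R ] x → (∀ r → x r * x r ≤ u r) →
                    d * d ≤ c * c * ℕ→ℚ R * sum u
sq-≤-of-abs-≤-sum {R} {d} c x u ∣d∣≤cΣx x²≤u = begin
  d * d                               ≡⟨ p*p≡∣p∣*∣p∣ d ⟩
  ∣ d ∣ * ∣ d ∣                       ≤⟨ *-mono-≤-nonNeg (0≤∣p∣ d) (0≤∣p∣ d) ∣d∣≤cΣx ∣d∣≤cΣx ⟩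
  (c * Σ[ R ] x) * (c * Σ[ R ] x)     ≡⟨ cong (λ s → (c * s) * (c * s)) (Σ≡sum R x) ⟩
  (c * sum x) * (c * sum x)           ≡⟨ solve 2 (λ c s → (c :* s) :* (c :* s) := c :* c :* (s :* s)) refl c (sum x) ⟩
  c * c * (sum x * sum x)             ≤⟨ *-monoˡ-≤-nonNeg (c * c) {{0≤c*c}} (sum²≤m*sum-sq x) ⟩
  c * c * (ℕ→ℚ R * sum (λ r → x r * x r))
    ≤⟨ *-monoˡ-≤-nonNeg (c * c) {{0≤c*c}} (*-monoˡ-≤-nonNeg (ℕ→ℚ R) {{nonNegative (0≤ℕ→ℚ R)}} (sum-mono-≤ x²≤u)) ⟩
  c * c * (ℕ→ℚ R * sum u)             ≡⟨ sym (*-assoc (c * c) (ℕ→ℚ R) (sum u)) ⟩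
  c * c * ℕ→ℚ R * sum u               ∎
  where
  open ≤-Reasoning
  0≤c*c = nonNegative (0≤p*p c)

normSq-≤-of-entrywise : ∀ {n R} (c : ℚ) (D : Mat n) (M W : Tensor n R) (ν : Fin R → ℚ) →
  (∀ i j → ∣ D i j ∣ ≤ c * Σ[ R ] (M i j)) →
  (∀ i j r → M i j r * M i j r ≤ ν r * (W i j r * W i j r)) →
  normSq n D ≤ c * c * ℕ→ℚ R * Σ[ R ] (λ r → ν r * normSq n (slice W r))
normSq-≤-of-entrywise {n} {R} c D M W ν ∣D∣≤cΣM M²≤νW² = begin
  normSq n D
    ≡⟨ Σ²≡sum² n (λ i j → D i j * D i j) ⟩
  sum (λ i → sum (λ j → D i j * D i j))
    ≤⟨ sum-mono-≤ (λ i → sum-mono-≤ (λ j →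
         sq-≤-of-abs-≤-sum c (M i j) (λ r → ν r * (W i j r * W i j r)) (∣D∣≤cΣM i j) (M²≤νW² i j))) ⟩
  sum (λ i → sum (λ j → a * sum (λ r → ν r * (W i j r * W i j r))))
    ≡⟨ sym (*-distribˡ-sum² a (λ i j → sum (λ r → ν r * (W i j r * W i j r)))) ⟩
  a * sum (λ i → sum (λ j → sum (λ r → ν r * (W i j r * W i j r))))
    ≡⟨ cong (a *_) (sum²-sum-comm (λ i j r → ν r * (W i j r * W i j r))) ⟩
  a * sum (λ r → sum (λ i → sum (λ j → ν r * (W i j r * W i j r))))
    ≡⟨ cong (a *_) (sum-cong-≗ λ r → trans (sym (*-distribˡ-sum² (ν r) (λ i j → W i j r * W i j r)))
                                          (cong (ν r *_) (sym (Σ²≡sum² n (λ i j → W i j r * W i j r))))) ⟩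
  a * sum (λ r → ν r * normSq n (slice W r))
    ≡⟨ cong (a *_) (sym (Σ≡sum R _)) ⟩
  a * Σ[ R ] (λ r → ν r * normSq n (slice W r)) ∎
  where
  open ≤-Reasoning
  a = c * c * ℕ→ℚ R

rounding-error : ∀ {ε δ z ẑ e m} → ∣ δ ∣ ≤ ε → ∣ ẑ - z ∣ ≤ e → ∣ z ∣ ≤ m →
                 ∣ ẑ * (1ℚ + δ) - z ∣ ≤ e * (1ℚ + ε) + m * ε
rounding-error {ε} {δ} {z} {ẑ} {e} {m} ∣δ∣≤ε ∣ẑ-z∣≤e ∣z∣≤m = begin
  ∣ ẑ * (1ℚ + δ) - z ∣
    ≡⟨ cong ∣_∣ (solve 3 (λ z ẑ δ → ẑ :* (con 1ℚ :+ δ) :- z := (ẑ :- z) :* (con 1ℚ :+ δ) :+ z :* δ) refl z ẑ δ) ⟩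
  ∣ (ẑ - z) * (1ℚ + δ) + z * δ ∣
    ≤⟨ ∣p+q∣≤∣p∣+∣q∣ ((ẑ - z) * (1ℚ + δ)) (z * δ) ⟩
  ∣ (ẑ - z) * (1ℚ + δ) ∣ + ∣ z * δ ∣
    ≡⟨ cong₂ _+_ (∣p*q∣≡∣p∣*∣q∣ (ẑ - z) (1ℚ + δ)) (∣p*q∣≡∣p∣*∣q∣ z δ) ⟩
  ∣ ẑ - z ∣ * ∣ 1ℚ + δ ∣ + ∣ z ∣ * ∣ δ ∣
    ≤⟨ +-mono-≤ (*-mono-≤-nonNeg (0≤∣p∣ (ẑ - z)) (0≤∣p∣ (1ℚ + δ)) ∣ẑ-z∣≤e ∣1+δ∣≤1+ε)
                (*-mono-≤-nonNeg (0≤∣p∣ z) (0≤∣p∣ δ) ∣z∣≤m ∣δ∣≤ε) ⟩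
  e * (1ℚ + ε) + m * ε ∎
  where
  open ≤-Reasoning
  ∣1+δ∣≤1+ε : ∣ 1ℚ + δ ∣ ≤ 1ℚ + ε
  ∣1+δ∣≤1+ε = ≤-trans (∣p+q∣≤∣p∣+∣q∣ 1ℚ δ) (+-monoʳ-≤ 1ℚ ∣δ∣≤ε)

flModel⇒0≤ε : ∀ {ε op flop} → FlModel ε op flop → 0ℚ ≤ ε
flModel⇒0≤ε model with model 0ℚ 0ℚ
... | δ , ∣δ∣≤ε , _ = ≤-trans (0≤∣p∣ δ) ∣δ∣≤ε

module RoundingError (ε : ℚ) (0≤ε : 0ℚ ≤ ε) where

  γ : ℕ → ℚ
  γ k = (1ℚ + ε) ^ k - 1ℚ

  1≤[1+ε]^ : ∀ k → 1ℚ ≤ (1ℚ + ε) ^ k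
  1≤[1+ε]^ ℕ.zero    = ≤-refl
  1≤[1+ε]^ (ℕ.suc k) =
    *-mono-≤-nonNeg (nonNegative⁻¹ 1ℚ) (nonNegative⁻¹ 1ℚ) (+-monoʳ-≤ 1ℚ 0≤ε) (1≤[1+ε]^ k)

  0≤γ : ∀ k → 0ℚ ≤ γ k
  0≤γ k = +-monoˡ-≤ (- 1ℚ) (1≤[1+ε]^ k)

  γ-mono : ∀ {k k'} → k ℕ.≤ k' → γ k ≤ γ k'
  γ-mono {k} k≤k' with ℕₚ.m≤n⇒∃[o]m+o≡n k≤k'
  ... | d , refl = +-monoˡ-≤ (- 1ℚ) (begin
    (1ℚ + ε) ^ k                ≡⟨ sym (*-identityʳ _) ⟩
    (1ℚ + ε) ^ k * 1ℚ           ≤⟨ *-monoˡ-≤-nonNeg ((1ℚ + ε) ^ k) {{0≤[1+ε]^k}} (1≤[1+ε]^ d) ⟩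
    (1ℚ + ε) ^ k * (1ℚ + ε) ^ d ≡⟨ sym (^-homo-* (1ℚ + ε) k d) ⟩
    (1ℚ + ε) ^ (k ℕ.+ d)        ∎)
    where
    open ≤-Reasoning
    0≤[1+ε]^k = nonNegative (≤-trans (nonNegative⁻¹ 1ℚ) (1≤[1+ε]^ k))

  record Approx (k : ℕ) (x̂ x m : ℚ) : Set where
    field
      error     : ∣ x̂ - x ∣ ≤ γ k * m
      magnitude : ∣ x ∣ ≤ m

  open Approx

  0≤magnitude : ∀ {k x̂ x m} → Approx k x̂ x m → 0ℚ ≤ m
  0≤magnitude {x = x} a = ≤-trans (0≤∣p∣ x) (magnitude a)

  approx-weaken : ∀ {k k' x̂ x m} → k ℕ.≤ k' → Approx k x̂ x m → Approx k' x̂ x m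
  approx-weaken {m = m} k≤k' a = record
    { error     = ≤-trans (error a) (*-monoʳ-≤-nonNeg m {{nonNegative (0≤magnitude a)}} (γ-mono k≤k'))
    ; magnitude = magnitude a
    }

  approx-exact : ∀ x → Approx 0 x x ∣ x ∣
  approx-exact x = record
    { error     = ≤-reflexive (trans (cong ∣_∣ (+-inverseʳ x)) (sym (*-zeroˡ ∣ x ∣)))
    ; magnitude = ≤-refl
    }

  ∣approx∣≤ : ∀ {k x̂ x m} → Approx k x̂ x m → ∣ x̂ ∣ ≤ (1ℚ + ε) ^ k * m
  ∣approx∣≤ {k} {x̂} {x} {m} a = begin
    ∣ x̂ ∣             ≡⟨ cong ∣_∣ (solve 2 (λ x̂ x → x̂ := x :+ (x̂ :- x)) refl x̂ x) ⟩
    ∣ x + (x̂ - x) ∣   ≤⟨ ∣p+q∣≤∣p∣+∣q∣ x (x̂ - x) ⟩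
    ∣ x ∣ + ∣ x̂ - x ∣ ≤⟨ +-mono-≤ (magnitude a) (error a) ⟩
    m + γ k * m       ≡⟨ solve 2 (λ m p → m :+ (p :- con 1ℚ) :* m := p :* m) refl m ((1ℚ + ε) ^ k) ⟩
    (1ℚ + ε) ^ k * m  ∎
    where open ≤-Reasoning

  approx-+ : ∀ {k x̂ x mx ŷ y my} → Approx k x̂ x mx → Approx k ŷ y my →
             Approx k (x̂ + ŷ) (x + y) (mx + my)
  approx-+ {k} {x̂} {x} {mx} {ŷ} {y} {my} a b = record
    { error     = begin
        ∣ (x̂ + ŷ) - (x + y) ∣
          ≡⟨ cong ∣_∣ (solve 4 (λ x̂ x ŷ y → (x̂ :+ ŷ) :- (x :+ y) := (x̂ :- x) :+ (ŷ :- y)) refl x̂ x ŷ y) ⟩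
        ∣ (x̂ - x) + (ŷ - y) ∣      ≤⟨ ∣p+q∣≤∣p∣+∣q∣ (x̂ - x) (ŷ - y) ⟩
        ∣ x̂ - x ∣ + ∣ ŷ - y ∣      ≤⟨ +-mono-≤ (error a) (error b) ⟩
        γ k * mx + γ k * my        ≡⟨ sym (*-distribˡ-+ (γ k) mx my) ⟩
        γ k * (mx + my)            ∎
    ; magnitude = ≤-trans (∣p+q∣≤∣p∣+∣q∣ x y) (+-mono-≤ (magnitude a) (magnitude b))
    }
    where open ≤-Reasoning

  approx-* : ∀ {k l x̂ x mx ŷ y my} → Approx k x̂ x mx → Approx l ŷ y my →
             Approx (k ℕ.+ l) (x̂ * ŷ) (x * y) (mx * my)
  approx-* {k} {l} {x̂} {x} {mx} {ŷ} {y} {my} a b = record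
    { error     = begin
        ∣ x̂ * ŷ - x * y ∣
          ≡⟨ cong ∣_∣ (solve 4 (λ x̂ x ŷ y → x̂ :* ŷ :- x :* y := (x̂ :- x) :* ŷ :+ x :* (ŷ :- y)) refl x̂ x ŷ y) ⟩
        ∣ (x̂ - x) * ŷ + x * (ŷ - y) ∣
          ≤⟨ ∣p+q∣≤∣p∣+∣q∣ ((x̂ - x) * ŷ) (x * (ŷ - y)) ⟩
        ∣ (x̂ - x) * ŷ ∣ + ∣ x * (ŷ - y) ∣
          ≡⟨ cong₂ _+_ (∣p*q∣≡∣p∣*∣q∣ (x̂ - x) ŷ) (∣p*q∣≡∣p∣*∣q∣ x (ŷ - y)) ⟩
        ∣ x̂ - x ∣ * ∣ ŷ ∣ + ∣ x ∣ * ∣ ŷ - y ∣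
          ≤⟨ +-mono-≤ (*-mono-≤-nonNeg (0≤∣p∣ (x̂ - x)) (0≤∣p∣ ŷ) (error a) (∣approx∣≤ b))
                      (*-mono-≤-nonNeg (0≤∣p∣ x) (0≤∣p∣ (ŷ - y)) (magnitude a) (error b)) ⟩
        γ k * mx * ((1ℚ + ε) ^ l * my) + mx * (γ l * my)
          ≡⟨ solve 4 (λ p q mx my → (p :- con 1ℚ) :* mx :* (q :* my) :+ mx :* ((q :- con 1ℚ) :* my)
                                    := (p :* q :- con 1ℚ) :* (mx :* my)) refl ((1ℚ + ε) ^ k) ((1ℚ + ε) ^ l) mx my ⟩
        ((1ℚ + ε) ^ k * (1ℚ + ε) ^ l - 1ℚ) * (mx * my)
          ≡⟨ cong (λ p → (p - 1ℚ) * (mx * my)) (sym (^-homo-* (1ℚ + ε) k l)) ⟩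
        γ (k ℕ.+ l) * (mx * my)    ∎
    ; magnitude = subst (_≤ mx * my) (sym (∣p*q∣≡∣p∣*∣q∣ x y))
                        (*-mono-≤-nonNeg (0≤∣p∣ x) (0≤∣p∣ y) (magnitude a) (magnitude b))
    }
    where open ≤-Reasoning

  approx-rounded : ∀ {k ẑ z m δ} → ∣ δ ∣ ≤ ε → Approx k ẑ z m → Approx (ℕ.suc k) (ẑ * (1ℚ + δ)) z m
  approx-rounded {k} {ẑ} {z} {m} ∣δ∣≤ε a = record
    { error     = ≤-trans (rounding-error {z = z} {ẑ} ∣δ∣≤ε (error a) (magnitude a)) (≤-reflexive
        (solve 3 (λ p m e → (p :- con 1ℚ) :* m :* (con 1ℚ :+ e) :+ m :* e := ((con 1ℚ :+ e) :* p :- con 1ℚ) :* m)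
               refl ((1ℚ + ε) ^ k) m ε))
    ; magnitude = magnitude a
    }

  approx-fl : ∀ {op flop} → FlModel ε op flop →
              ∀ {k x̂ ŷ z m} → Approx k (op x̂ ŷ) z m → Approx (ℕ.suc k) (flop x̂ ŷ) z m
  approx-fl model {x̂ = x̂} {ŷ} a with model x̂ ŷ
  ... | δ , ∣δ∣≤ε , fl≡ = subst (λ w → Approx _ w _ _) (sym fl≡) (approx-rounded ∣δ∣≤ε a)

  module _ {flAdd : ℚ → ℚ → ℚ} (fl-+ : FlModel ε _+_ flAdd) where

    approx-foldl : ∀ {I : Set} (is : List I) {x̂ x m : I → ℚ} {k j â a m₀} → k ℕ.≤ j →
                   (∀ i → Approx k (x̂ i) (x i) (m i)) → Approx j â a m₀ →
                   Approx (j ℕ.+ length is) (foldl flAdd â (map x̂ is)) (foldl _+_ a (map x is))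
                          (foldl _+_ m₀ (map m is))
    approx-foldl []       {j = j} k≤j terms acc = approx-weaken (ℕₚ.m≤m+n j 0) acc
    approx-foldl (i ∷ is) {x̂} {x} {m} {j = j} k≤j terms acc =
      approx-weaken (ℕₚ.≤-reflexive (sym (ℕₚ.+-suc j (length is))))
        (approx-foldl is {x̂} {x} {m} (ℕₚ.m≤n⇒m≤1+n k≤j) terms
          (approx-fl {_+_} fl-+ (approx-+ acc (approx-weaken k≤j (terms i)))))

    approx-ΣF : ∀ m {x̂ x mg : Fin (ℕ.suc m) → ℚ} {k} → (∀ i → Approx k (x̂ i) (x i) (mg i)) →
                Approx (k ℕ.+ m) (ΣF flAdd (ℕ.suc m) x̂) (Σ[ ℕ.suc m ] x) (Σ[ ℕ.suc m ] mg)
    approx-ΣF m {x̂} {x} {mg} {k} terms = approx-weaken (ℕₚ.≤-reflexive (cong (k ℕ.+_) (length-tabulate suc)))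
      (approx-foldl (tabulate suc) {x̂} {x} {mg} ℕₚ.≤-refl terms (terms zero))

  γ-≤ : ∀ k → ℕ→ℚ k * ε ≤ 1ℚ → γ k ≤ ℕ→ℚ k * ε * (1ℚ + ℕ→ℚ k * ε)
  γ-≤ ℕ.zero    _ rewrite *-zeroˡ ε = ≤-refl
  γ-≤ (ℕ.suc k) [k+1]ε≤1 = begin
    γ (ℕ.suc k)
      ≡⟨ solve 2 (λ p e → (con 1ℚ :+ e) :* p :- con 1ℚ := (con 1ℚ :+ e) :* (p :- con 1ℚ) :+ e)
               refl ((1ℚ + ε) ^ k) ε ⟩
    (1ℚ + ε) * γ k + ε
      ≤⟨ +-monoˡ-≤ ε (*-monoˡ-≤-nonNeg (1ℚ + ε) {{nonNegative (+-mono-≤ (nonNegative⁻¹ 1ℚ) 0≤ε)}}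
                                       (γ-≤ k t≤1)) ⟩
    (1ℚ + ε) * (t * (1ℚ + t)) + ε
      ≡⟨ sym (+-identityʳ _) ⟩
    (1ℚ + ε) * (t * (1ℚ + t)) + ε + 0ℚ
      ≤⟨ +-monoʳ-≤ ((1ℚ + ε) * (t * (1ℚ + t)) + ε) (*-nonNeg 0≤ε (+-mono-≤ 0≤t-t² 0≤ε)) ⟩
    (1ℚ + ε) * (t * (1ℚ + t)) + ε + ε * (t - t * t + ε)
      ≡⟨ solve 2 (λ t e → (con 1ℚ :+ e) :* (t :* (con 1ℚ :+ t)) :+ e :+ e :* (t :- t :* t :+ e)
                          := (e :+ t) :* (con 1ℚ :+ (e :+ t))) refl t ε ⟩
    (ε + t) * (1ℚ + (ε + t))
      ≡⟨ cong (λ s → s * (1ℚ + s)) (sym [k+1]ε≡ε+t) ⟩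
    ℕ→ℚ (ℕ.suc k) * ε * (1ℚ + ℕ→ℚ (ℕ.suc k) * ε) ∎
    where
    open ≤-Reasoning
    t = ℕ→ℚ k * ε
    [k+1]ε≡ε+t : ℕ→ℚ (ℕ.suc k) * ε ≡ ε + t
    [k+1]ε≡ε+t = trans (cong (λ s → s * ε) (ℕ→ℚ-suc k))
                       (trans (*-distribʳ-+ ε 1ℚ (ℕ→ℚ k)) (cong (λ s → s + t) (*-identityˡ ε)))
    t≤1 : t ≤ 1ℚ
    t≤1 = ≤-trans (≤-trans (≤-reflexive (sym (+-identityˡ t))) (+-monoˡ-≤ t 0≤ε))
                  (subst (_≤ 1ℚ) [k+1]ε≡ε+t [k+1]ε≤1)
    t*t≤t : t * t ≤ t
    t*t≤t = ≤-trans (*-monoˡ-≤-nonNeg t {{nonNegative (*-nonNeg (0≤ℕ→ℚ k) 0≤ε)}} t≤1)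
                    (≤-reflexive (*-identityʳ t))
    0≤t-t² : 0ℚ ≤ t - t * t
    0≤t-t² = subst (_≤ t - t * t) (+-inverseʳ (t * t)) (+-monoˡ-≤ (- (t * t)) t*t≤t)

module Evaluation {ε : ℚ} {flAdd flMul : ℚ → ℚ → ℚ}
                  (fl-+ : FlModel ε _+_ flAdd) (fl-* : FlModel ε _*_ flMul) where

  open RoundingError ε (flModel⇒0≤ε {op = _+_} fl-+) public

  flDot : ∀ {n} → Mat n → Mat n → ℚ
  flDot {n} X Y = ΣF flAdd n (λ k → ΣF flAdd n (λ l → flMul (X k l) (Y k l)))

  flDot-approx : ∀ n (X Y : Mat (ℕ.suc n)) →
                 Approx (1 ℕ.+ n ℕ.+ n) (flDot X Y) ⟪ X , Y ⟫ ⟪ ∣ X ∣ₘ , ∣ Y ∣ₘ ⟫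
  flDot-approx n X Y = approx-ΣF fl-+ n λ k → approx-ΣF fl-+ n λ l →
    approx-fl {_*_} fl-* (approx-* (approx-exact (X k l)) (approx-exact (Y k l)))

  -- Two inner products of depth 2n − 1, two products with w, and R − 1 additions.
  evaluation-depth : ∀ n R → ℕ.suc (ℕ.suc (0 ℕ.+ (1 ℕ.+ n ℕ.+ n)) ℕ.+ (1 ℕ.+ n ℕ.+ n)) ℕ.+ R
                             ≡ 4 ℕ.* ℕ.suc n ℕ.+ ℕ.suc R ℕ.∸ 1
  evaluation-depth n R = trans (depth n R) (cong (ℕ._∸ 1) (sym (ℕₚ.+-suc (4 ℕ.* ℕ.suc n) R)))
    where
    depth : ∀ n R → ℕ.suc (ℕ.suc (0 ℕ.+ (1 ℕ.+ n ℕ.+ n)) ℕ.+ (1 ℕ.+ n ℕ.+ n)) ℕ.+ R ≡ 4 ℕ.* ℕ.suc n ℕ.+ R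
    depth = ℕ-solve-∀

  fFl-entry-error : ∀ n R (U V W : Tensor (ℕ.suc n) (ℕ.suc R)) (A B : Mat (ℕ.suc n)) i j →
    ∣ (fFl flAdd flMul (ℕ.suc n) (ℕ.suc R) U V W A B -ₘ fExact (ℕ.suc n) (ℕ.suc R) U V W A B) i j ∣
      ≤ γ (4 ℕ.* ℕ.suc n ℕ.+ ℕ.suc R ℕ.∸ 1)
        * Σ[ ℕ.suc R ] (λ r → ∣ W i j r ∣ * ⟪ ∣ slice U r ∣ₘ , ∣ A ∣ₘ ⟫ * ⟪ ∣ slice V r ∣ₘ , ∣ B ∣ₘ ⟫)
  fFl-entry-error n R U V W A B i j =
    Approx.error (approx-weaken (ℕₚ.≤-reflexive (evaluation-depth n R)) (approx-ΣF fl-+ R λ r →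
      approx-fl {_*_} fl-* (approx-*
        (approx-fl {_*_} fl-* (approx-* (approx-exact (W i j r)) (flDot-approx n (slice U r) A)))
        (flDot-approx n (slice V r) B))))

  fFl-normSq-error : ∀ n R (U V W : Tensor (ℕ.suc n) (ℕ.suc R)) (A B : Mat (ℕ.suc n)) →
    let N = ℕ.suc n; c = γ (4 ℕ.* N ℕ.+ ℕ.suc R ℕ.∸ 1) in
    normSq N (fFl flAdd flMul N (ℕ.suc R) U V W A B -ₘ fExact N (ℕ.suc R) U V W A B)
      ≤ c * c * ℕ→ℚ (ℕ.suc R) * (normSq N A * normSq N B
          * Σ[ ℕ.suc R ] (λ r → normSq N (slice U r) * normSq N (slice V r) * normSq N (slice W r)))
  fFl-normSq-error n R U V W A B =
    ≤-trans (normSq-≤-of-entrywise c D M W ν (fFl-entry-error n R U V W A B) M²≤νW²)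
            (≤-reflexive (cong (λ s → c * c * ℕ→ℚ (ℕ.suc R) * s) weights))
    where
    open ≡-Reasoning
    N = ℕ.suc n
    c = γ (4 ℕ.* N ℕ.+ ℕ.suc R ℕ.∸ 1)
    D = fFl flAdd flMul N (ℕ.suc R) U V W A B -ₘ fExact N (ℕ.suc R) U V W A B
    M : Tensor N (ℕ.suc R)
    M i j r = ∣ W i j r ∣ * ⟪ ∣ slice U r ∣ₘ , ∣ A ∣ₘ ⟫ * ⟪ ∣ slice V r ∣ₘ , ∣ B ∣ₘ ⟫
    nU nV nW ν : Fin (ℕ.suc R) → ℚ
    nU r = normSq N (slice U r)
    nV r = normSq N (slice V r)
    nW r = normSq N (slice W r)
    ν r = (nU r * normSq N A) * (nV r * normSq N B)
    M²≤νW² : ∀ i j r → M i j r * M i j r ≤ ν r * (W i j r * W i j r)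
    M²≤νW² i j r = weighted-product-sq-≤ {W i j r} (⟪∣∣⟫-cauchy-schwarz (slice U r) A)
                                                   (⟪∣∣⟫-cauchy-schwarz (slice V r) B)
    weights : Σ[ ℕ.suc R ] (λ r → ν r * nW r)
              ≡ normSq N A * normSq N B * Σ[ ℕ.suc R ] (λ r → nU r * nV r * nW r)
    weights = begin
      Σ[ ℕ.suc R ] (λ r → ν r * nW r)
        ≡⟨ Σ≡sum (ℕ.suc R) (λ r → ν r * nW r) ⟩
      sum (λ r → ν r * nW r)
        ≡⟨ sum-cong-≗ (λ r → solve 5 (λ u a v b w → (u :* a) :* (v :* b) :* w := a :* b :* (u :* v :* w))
                                       refl (nU r) (normSq N A) (nV r) (normSq N B) (nW r)) ⟩
      sum (λ r → normSq N A * normSq N B * (nU r * nV r * nW r))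
        ≡⟨ sym (*-distribˡ-sum (normSq N A * normSq N B) (λ r → nU r * nV r * nW r)) ⟩
      normSq N A * normSq N B * sum (λ r → nU r * nV r * nW r)
        ≡⟨ cong (λ s → normSq N A * normSq N B * s) (sym (Σ≡sum (ℕ.suc R) (λ r → nU r * nV r * nW r))) ⟩
      normSq N A * normSq N B * Σ[ ℕ.suc R ] (λ r → nU r * nV r * nW r) ∎

proposition5 :
    (n R : ℕ) → 1 ℕ.≤ n → 1 ℕ.≤ R →
    (U V W : Tensor n R) → (A B : Mat n) →
    (ε : ℚ) → (flAdd flMul : ℚ → ℚ → ℚ) →
    FlModel ε _+_ flAdd → FlModel ε _*_ flMul →
    ℕ→ℚ (4 ℕ.* n ℕ.+ R ℕ.∸ 1) * ε ≤ + 1 / 100 →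
    normSq n (fFl flAdd flMul n R U V W A B -ₘ fExact n R U V W A B)
      ≤ (+ 101 / 100) * (+ 101 / 100)
        * (ℕ→ℚ (4 ℕ.* n ℕ.+ R ℕ.∸ 1) * ℕ→ℚ (4 ℕ.* n ℕ.+ R ℕ.∸ 1))
        * ℕ→ℚ R * (ε * ε)
        * normSq n A * normSq n B
        * (Σ[ R ] (λ r → normSq n (slice U r) * normSq n (slice V r) * normSq n (slice W r)))
proposition5 (ℕ.suc n) (ℕ.suc R) _ _ U V W A B ε flAdd flMul fl-+ fl-* Kε≤1/100 = begin
  normSq N (fFl flAdd flMul N (ℕ.suc R) U V W A B -ₘ fExact N (ℕ.suc R) U V W A B)
    ≤⟨ fFl-normSq-error n R U V W A B ⟩
  γ K * γ K * ℕ→ℚ (ℕ.suc R) * (normSq N A * normSq N B * S)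
    ≤⟨ *-monoʳ-≤-nonNeg _ {{nonNegative 0≤nA*nB*S}}
         (*-monoʳ-≤-nonNeg (ℕ→ℚ (ℕ.suc R)) {{nonNegative (0≤ℕ→ℚ (ℕ.suc R))}}
           (*-mono-≤-nonNeg (0≤γ K) (0≤γ K) γK≤ γK≤)) ⟩
  (ℕ→ℚ K * ε * q) * (ℕ→ℚ K * ε * q) * ℕ→ℚ (ℕ.suc R) * (normSq N A * normSq N B * S)
    ≡⟨ solve 7 (λ k e q r a b s → (k :* e :* q) :* (k :* e :* q) :* r :* (a :* b :* s)
                                  := q :* q :* (k :* k) :* r :* (e :* e) :* a :* b :* s)
             refl (ℕ→ℚ K) ε q (ℕ→ℚ (ℕ.suc R)) (normSq N A) (normSq N B) S ⟩
  q * q * (ℕ→ℚ K * ℕ→ℚ K) * ℕ→ℚ (ℕ.suc R) * (ε * ε) * normSq N A * normSq N B * S ∎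
  where
  open ≤-Reasoning
  open Evaluation fl-+ fl-*
  N = ℕ.suc n
  K = 4 ℕ.* N ℕ.+ ℕ.suc R ℕ.∸ 1
  q = + 101 / 100
  S = Σ[ ℕ.suc R ] (λ r → normSq N (slice U r) * normSq N (slice V r) * normSq N (slice W r))
  0≤ε = flModel⇒0≤ε {op = _+_} fl-+
  γK≤ : γ K ≤ ℕ→ℚ K * ε * q
  γK≤ = ≤-trans (γ-≤ K (≤-trans Kε≤1/100 (toWitness {a? = + 1 / 100 ≤? 1ℚ} tt)))
                (*-monoˡ-≤-nonNeg (ℕ→ℚ K * ε) {{nonNegative (*-nonNeg (0≤ℕ→ℚ K) 0≤ε)}} (+-monoʳ-≤ 1ℚ Kε≤1/100))
  0≤nA*nB*S : 0ℚ ≤ normSq N A * normSq N B * S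
  0≤nA*nB*S = *-nonNeg (*-nonNeg (0≤normSq A) (0≤normSq B))
    (subst (0ℚ ≤_) (sym (Σ≡sum (ℕ.suc R) _))
      (sum-nonNeg (λ r → *-nonNeg (*-nonNeg (0≤normSq (slice U r)) (0≤normSq (slice V r))) (0≤normSq (slice W r)))))
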